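{- Let $\Gamma$ be a $G$-strongly incidence-transitive code in $J(\mathcal V,k)$ with $\Delta\in\Gamma$. Let $M$ be a subgroup of $G\le\mathrm{Aut}(\Gamma)$ which acts transitively on $\mathcal V$ while leaving invariant a nontrivial partition $\mathcal I$ of $\mathcal V$. If $G_\Delta<M\le G$, then $\Delta$ is a union of parts of $\mathcal I$.
   Context: $J(\mathcal V,k)$ is the Johnson graph on the $k$-subsets of a finite set $\mathcal V$ (adjacent iff they meet in $k-1$ points). A code is a nonempty set $\Gamma$ of vertices; $\mathrm{Aut}(\Gamma)$ is the group of graph automorphisms preserving $\Gamma$. For a group $G\le\mathrm{Aut}(\Gamma)\cap\mathrm{Sym}(\mathcal V)$, $\Gamma$ is $G$-strongly incidence-transitive if $G$ is transitive on $\Gamma$ and, for each $\Delta\in\Gamma$, the setwise stabiliser $G_\Delta$ is transitive on $\Delta\times(\mathcal V\setminus\Delta)$. A partition is nontrivial if it has more than one part and not all parts are singletons. -}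

module Defs where

open import Data.Nat.Base using (ℕ)
open import Data.Fin.Base using (Fin)
open import Data.Fin.Subset using (Subset; _∈_; _∉_; ∣_∣)
open import Data.Fin.Permutation
  using (Permutation′; _⟨$⟩ʳ_; _⟨$⟩ˡ_; id; flip; _∘ₚ_; _≈_)
open import Data.Vec.Base using (tabulate; lookup)
open import Data.Product.Base using (Σ; _×_; ∃-syntax)
open import Relation.Binary.Core using (Rel)
open import Relation.Binary.Structures using (IsEquivalence)
open import Relation.Binary.PropositionalEquality using (_≡_; _≢_)
open import Relation.Nullary using (¬_)
open import Level using (0ℓ)

-- The point set V is Fin n; permutations of V are elements of Sym(V).
Perm : ℕ → Set
Perm n = Permutation′ n

PermSet : ℕ → Set₁
PermSet n = Perm n → Set

-- Image σ(Δ) = { σ x | x ∈ Δ } of a subset under a permutation: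
-- j ∈ σ(Δ) iff σ⁻¹ j ∈ Δ.
image : ∀ {n} → Perm n → Subset n → Subset n
image σ Δ = tabulate (λ j → lookup Δ (σ ⟨$⟩ˡ j))

record IsPermGroup {n : ℕ} (H : PermSet n) : Set where
  field
    respects : ∀ {σ τ} → σ ≈ τ → H σ → H τ
    has-id   : H id
    closed-∘ : ∀ {σ τ} → H σ → H τ → H (σ ∘ₚ τ)
    closed-⁻¹ : ∀ {σ} → H σ → H (flip σ)

_⊆ₚ_ : ∀ {n} → PermSet n → PermSet n → Set
H ⊆ₚ K = ∀ σ → H σ → K σ

record IsCode (n k : ℕ) (Γ : Subset n → Set) : Set where
  field
    nonempty : ∃[ Δ ] Γ Δ
    k-subsets : ∀ Δ → Γ Δ → ∣ Δ ∣ ≡ k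

-- G ≤ Aut(Γ) ∩ Sym(V): every element of G maps Γ to Γ.
-- (Since Γ is finite and G is a group, this gives setwise invariance.)
PreservesCode : ∀ {n} → PermSet n → (Subset n → Set) → Set
PreservesCode G Γ = ∀ σ → G σ → ∀ Δ → Γ Δ → Γ (image σ Δ)

Stab : ∀ {n} → PermSet n → Subset n → PermSet n
Stab G Δ σ = G σ × image σ Δ ≡ Δ

record StronglyIncidenceTransitive {n : ℕ} (G : PermSet n)
         (Γ : Subset n → Set) : Set where
  field
    transitive : ∀ Δ Δ′ → Γ Δ → Γ Δ′ → ∃[ σ ] (G σ × image σ Δ ≡ Δ′)
    flag-transitive : ∀ Δ → Γ Δ → ∀ α β γ δ →
      α ∈ Δ → β ∈ Δ → γ ∉ Δ → δ ∉ Δ →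
      ∃[ σ ] (Stab G Δ σ × σ ⟨$⟩ʳ α ≡ β × σ ⟨$⟩ʳ γ ≡ δ)

TransitiveOnV : ∀ {n} → PermSet n → Set
TransitiveOnV H = ∀ x y → ∃[ σ ] (H σ × σ ⟨$⟩ʳ x ≡ y)

-- A partition of V, represented by its equivalence relation
-- ("x and y lie in the same part").
-- Nontrivial: more than one part, and not all parts are singletons.
record IsNontrivialPartition {n : ℕ} (R : Rel (Fin n) 0ℓ) : Set where
  field
    isEquivalence : IsEquivalence R
    two-parts : ∃[ x ] ∃[ y ] ¬ R x y
    non-singleton : ∃[ x ] ∃[ y ] (x ≢ y × R x y)

LeavesInvariant : ∀ {n} → PermSet n → Rel (Fin n) 0ℓ → Set
LeavesInvariant H R = ∀ σ → H σ → ∀ x y → R x y → R (σ ⟨$⟩ʳ x) (σ ⟨$⟩ʳ y)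

UnionOfParts : ∀ {n} → Rel (Fin n) 0ℓ → Subset n → Set
UnionOfParts R Δ = ∀ x y → R x y → x ∈ Δ → y ∈ Δ

-- If some part of the M-invariant partition met both Δ and its complement,
-- then, since G_Δ ≤ M preserves the partition and is transitive on the flags
-- Δ × (V ∖ Δ), every point of Δ would lie in the same part as every point
-- outside Δ. As Δ and its complement are both nonempty, the partition would
-- then have a single part.
module Submission where

open import Defs
open import Data.Nat.Base using (ℕ)
open import Data.Fin.Base using (Fin)
open import Data.Fin.Subset using (Subset; _∈_; _∉_)
open import Data.Fin.Subset.Properties using (_∈?_)
open import Data.Fin.Permutation using (_⟨$⟩ʳ_)
open import Data.Product.Base using (_×_; _,_; ∃-syntax)
open import Data.Empty using (⊥-elim)
open import Relation.Nullary using (yes; no)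
open import Relation.Binary.Core using (Rel)
open import Relation.Binary.Structures using (IsEquivalence)
open import Relation.Binary.PropositionalEquality using (_≡_; _≢_; subst₂)
open import Level using (0ℓ)

module _ {n : ℕ} where

  FlagTransitiveOn : PermSet n → Subset n → Set
  FlagTransitiveOn H Δ = ∀ α β γ δ → α ∈ Δ → β ∈ Δ → γ ∉ Δ → δ ∉ Δ →
    ∃[ σ ] (H σ × σ ⟨$⟩ʳ α ≡ β × σ ⟨$⟩ʳ γ ≡ δ)

  FlagTransitiveOn-mono : ∀ {H K Δ} → H ⊆ₚ K →
    FlagTransitiveOn H Δ → FlagTransitiveOn K Δ
  FlagTransitiveOn-mono H⊆K flags α β γ δ α∈ β∈ γ∉ δ∉
    with flags α β γ δ α∈ β∈ γ∉ δ∉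
  ... | σ , Hσ , σα≡β , σγ≡δ = σ , H⊆K σ Hσ , σα≡β , σγ≡δ

  AcrossRelated : Rel (Fin n) 0ℓ → Subset n → Set
  AcrossRelated R Δ = ∀ a b → a ∈ Δ → b ∉ Δ → R a b

  invariant-flagTransitive⇒acrossRelated : ∀ {H R Δ x y} →
    LeavesInvariant H R → FlagTransitiveOn H Δ →
    R x y → x ∈ Δ → y ∉ Δ → AcrossRelated R Δ
  invariant-flagTransitive⇒acrossRelated {x = x} {y} inv flags Rxy x∈Δ y∉Δ a b a∈Δ b∉Δ
    with flags x a y b x∈Δ a∈Δ y∉Δ b∉Δ
  ... | σ , Hσ , σx≡a , σy≡b = subst₂ _ σx≡a σy≡b (inv σ Hσ x y Rxy)

  acrossRelated⇒total : ∀ {R Δ x y} → IsEquivalence R →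
    AcrossRelated R Δ → x ∈ Δ → y ∉ Δ → ∀ a b → R a b
  acrossRelated⇒total {Δ = Δ} {x} {y} isEq across x∈Δ y∉Δ a b
    with a ∈? Δ | b ∈? Δ
  ... | yes a∈Δ | no  b∉Δ = across a b a∈Δ b∉Δ
  ... | no  a∉Δ | yes b∈Δ = sym (across b a b∈Δ a∉Δ)
    where open IsEquivalence isEq
  ... | yes a∈Δ | yes b∈Δ = trans (across a y a∈Δ y∉Δ) (sym (across b y b∈Δ y∉Δ))
    where open IsEquivalence isEq
  ... | no  a∉Δ | no  b∉Δ = trans (sym (across x a x∈Δ a∉Δ)) (across x b x∈Δ b∉Δ)
    where open IsEquivalence isEq

lemma4p1 : (n k : ℕ) (Γ : Subset n → Set) (G M : PermSet n)
    (R : Rel (Fin n) 0ℓ) (Δ : Subset n) →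
    IsCode n k Γ → IsPermGroup G → PreservesCode G Γ →
    StronglyIncidenceTransitive G Γ → Γ Δ →
    IsPermGroup M → M ⊆ₚ G → TransitiveOnV M →
    IsNontrivialPartition R → LeavesInvariant M R →
    Stab G Δ ⊆ₚ M → (∃[ σ ] (M σ × image σ Δ ≢ Δ)) →
    UnionOfParts R Δ
lemma4p1 n k Γ G M R Δ _ _ _ sit ΓΔ _ _ _ part inv GΔ⊆M _ x y Rxy x∈Δ
  with y ∈? Δ
... | yes y∈Δ = y∈Δ
... | no  y∉Δ with IsNontrivialPartition.two-parts part
...   | p , q , ¬Rpq = ⊥-elim (¬Rpq (acrossRelated⇒total isEquivalence across x∈Δ y∉Δ p q))
  where
  open IsNontrivialPartition part using (isEquivalence)
  flagsM : FlagTransitiveOn M Δ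
  flagsM = FlagTransitiveOn-mono GΔ⊆M (StronglyIncidenceTransitive.flag-transitive sit Δ ΓΔ)
  across : AcrossRelated R Δ
  across = invariant-flagTransitive⇒acrossRelated inv flagsM Rxy x∈Δ y∉Δ
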